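{- Let $\mathcal{E}$ be a system of $m \geq 1$ Boolean equations. If $\mathcal{E}$ has a solution over $\mathbb{N}$, then $\mathcal{E}$ has a solution over $\mathbb{N}$ with at most $\frac{5}{2} m \log_2 m + 1$ non-zero entries.
   Context: A Boolean equation is an equation of the form $a_1 x_1 + \cdots + a_n x_n = c$, where each $a_i \in \{0,1\}$ and $c$ is a natural number. $\mathbb{N}$ denotes the natural numbers including $0$. -}

module Defs where

open import Data.Nat using (ℕ; zero; suc; _+_; _*_; _^_; _≤_; _∸_)
open import Data.Bool using (Bool; true; false; if_then_else_)
open import Data.Fin using (Fin)
open import Data.Vec.Functional using (foldr)
open import Relation.Binary.PropositionalEquality using (_≡_)

sumFin : ∀ {n} → (Fin n → ℕ) → ℕ
sumFin f = foldr _+_ 0 f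

-- A Boolean equation in n variables: a coefficient vector with entries in {0,1}
-- (true = 1, false = 0) and a right-hand side c ∈ ℕ.
coef : Bool → ℕ
coef true  = 1
coef false = 0

record BoolEq (n : ℕ) : Set where
  constructor mkEq
  field
    a : Fin n → Bool
    c : ℕ

Satisfies : ∀ {n} → BoolEq n → (Fin n → ℕ) → Set
Satisfies e x = sumFin (λ i → coef (BoolEq.a e i) * x i) ≡ BoolEq.c e

System : ℕ → ℕ → Set
System m n = Fin m → BoolEq n

IsSolution : ∀ {m n} → System m n → (Fin n → ℕ) → Set
IsSolution E x = ∀ j → Satisfies (E j) x

nonZero : ℕ → ℕ
nonZero zero    = 0
nonZero (suc _) = 1

supportSize : ∀ {n} → (Fin n → ℕ) → ℕ
supportSize x = sumFin (λ i → nonZero (x i))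

-- k ≤ (5/2)·m·log₂ m + 1, for m ≥ 1, stated without reals:
-- equivalent to 2(k−1) ≤ 5 m log₂ m, i.e. 4^(k∸1) ≤ m^(5m)
-- (for k = 0 both sides hold trivially since m ≥ 1).
WithinBound : ℕ → ℕ → Set
WithinBound m k = 4 ^ (k ∸ 1) ≤ m ^ (5 * m)

{-# OPTIONS --safe #-}
-- Let x be a solution whose support has k elements and take s ≤ k. Each of the 2^s subsets σ of
-- the first s support positions of x has a count vector (|A_j ∩ σ|)_j in {0, …, s}^m, so if
-- (s+1)^m < 2^s two distinct subsets σ ≠ τ have the same counts. Then x − 1_σ + 1_τ is again a
-- solution whose support lies inside that of x, and repeating this exchange until a coordinate of
-- σ ∖ τ reaches zero strictly shrinks the support. When 4^(k−1) > m^(5m) such an s exists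
-- (s = k if k < 2m², s = 2m² otherwise), so descent on the support size ends within the bound.
module Submission where

open import Defs
open import Data.Nat
  using (ℕ; zero; suc; _+_; _*_; _∸_; _^_; _≤_; _<_; z≤n; s≤s; _≤?_; _<?_)
open import Data.Nat.Properties
open import Algebra.Properties.CommutativeMonoid.Sum +-0-commutativeMonoid
  using (∑-distrib-+; sum-cong-≗)
open import Algebra.Properties.CommutativeSemigroup +-commutativeSemigroup
  using (xy∙z≈xz∙y)
open import Data.Bool using (Bool; true; false; T)
open import Data.Fin using (Fin; zero; suc; toℕ; fromℕ<; combine; finToFun; funToFin)
open import Data.Fin.Properties
  using (pigeonhole; funToFin-finToFin; finToFun-funToFin; ¬∀⟶∃¬; toℕ-fromℕ<; 2↔Bool)
  renaming (_≟_ to _≟ᶠ_)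
open import Data.Nat.Induction using (<-wellFounded)
open import Data.Nat.Tactic.RingSolver using (solve-∀)
open import Data.Product using (Σ; ∃; ∃₂; _×_; _,_; proj₂)
open import Data.Sum using (_⊎_; inj₁; inj₂)
open import Data.Unit using (tt)
open import Data.Vec.Functional using ([]; _∷_; head; tail)
open import Function using (_∘_)
open import Function.Bundles using (Inverse; Injection)
open import Function.Properties.Inverse using (↔⇒↣)
open import Induction.WellFounded using (Acc; acc)
open import Level using (0ℓ)
open import Relation.Nullary using (¬_; Dec; yes; no; contradiction)
open import Relation.Unary using (Pred; _⊆_)
open import Relation.Unary.Properties using (⊆-trans)
open import Relation.Binary.PropositionalEquality

private
  variable
    m n s : ℕ

descent : {A : Set} {P Q : A → Set} (μ : A → ℕ) →
          (∀ x → P x → Q x ⊎ ∃ λ y → P y × μ y < μ x) →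
          ∀ x → P x → ∃ λ y → P y × Q y
descent {P = P} {Q} μ step x = go x (<-wellFounded (μ x))
  where
  go : ∀ x → Acc _<_ (μ x) → P x → ∃ λ y → P y × Q y
  go x (acc rs) px with step x px
  ... | inj₁ qx               = x , px , qx
  ... | inj₂ (y , py , μy<μx) = go y (rs μy<μx) py

sumFin-mono-≤ : {f g : Fin n → ℕ} → (∀ i → f i ≤ g i) → sumFin f ≤ sumFin g
sumFin-mono-≤ {zero}  f≤g = z≤n
sumFin-mono-≤ {suc n} f≤g = +-mono-≤ (f≤g zero) (sumFin-mono-≤ (f≤g ∘ suc))

sumFin-mono-< : {f g : Fin n → ℕ} → (∀ i → f i ≤ g i) → ∀ i → f i < g i → sumFin f < sumFin g
sumFin-mono-< f≤g zero    f[i]<g[i] = +-mono-<-≤ f[i]<g[i] (sumFin-mono-≤ (f≤g ∘ suc))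
sumFin-mono-< f≤g (suc i) f[i]<g[i] = +-mono-≤-< (f≤g zero) (sumFin-mono-< (f≤g ∘ suc) i f[i]<g[i])

funToFin-cong : {f g : Fin m → Fin n} → (∀ i → f i ≡ g i) → funToFin f ≡ funToFin g
funToFin-cong {zero}  f≗g = refl
funToFin-cong {suc m} f≗g = cong₂ combine (f≗g zero) (funToFin-cong (f≗g ∘ suc))

pigeonhole-→ : ∀ {a b} → a ^ m < b ^ s →
               (f : (Fin s → Fin b) → Fin m → ℕ) → (∀ u j → f u j < a) →
               ∃₂ λ u v → (∃ λ k → u k ≢ v k) × (∀ j → f u j ≡ f v j)
pigeonhole-→ {m} {s} {a} {b} a^m<b^s f f<a
  with p , q , p<q , code[p]≡code[q] ←
         pigeonhole a^m<b^s (λ p → funToFin (λ j → fromℕ< (f<a (finToFun {b} {s} p) j)))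
  = decode p , decode q , differ , agree
  where
  open ≡-Reasoning
  decode : Fin (b ^ s) → Fin s → Fin b
  decode = finToFun
  code : (Fin s → Fin b) → Fin m → Fin a
  code u j = fromℕ< (f<a u j)
  agree : ∀ j → f (decode p) j ≡ f (decode q) j
  agree j = begin
    f (decode p) j                                ≡⟨ toℕ-fromℕ< (f<a (decode p) j) ⟨
    toℕ (code (decode p) j)                       ≡⟨ cong toℕ (finToFun-funToFin (code (decode p)) j) ⟨
    toℕ (finToFun (funToFin (code (decode p))) j) ≡⟨ cong (λ c → toℕ (finToFun c j)) code[p]≡code[q] ⟩
    toℕ (finToFun (funToFin (code (decode q))) j) ≡⟨ cong toℕ (finToFun-funToFin (code (decode q)) j) ⟩
    toℕ (code (decode q) j)                       ≡⟨ toℕ-fromℕ< (f<a (decode q) j) ⟩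
    f (decode q) j                                ∎
  decode-injective : ¬ (∀ k → decode p k ≡ decode q k)
  decode-injective same = <⇒≢ p<q (cong toℕ (begin
    p                    ≡⟨ funToFin-finToFin {s} {b} p ⟨
    funToFin (decode p)  ≡⟨ funToFin-cong same ⟩
    funToFin (decode q)  ≡⟨ funToFin-finToFin {s} {b} q ⟩
    q                    ∎))
  differ : ∃ λ k → decode p k ≢ decode q k
  differ = ¬∀⟶∃¬ s _ (λ k → decode p k ≟ᶠ decode q k) decode-injective

n<2^n : ∀ n → n < 2 ^ n
n<2^n zero    = s≤s z≤n
n<2^n (suc n) = ≤-trans (+-mono-≤ (m^n>0 2 n) (n<2^n n))
                        (≤-reflexive (cong (2 ^ n +_) (sym (+-identityʳ (2 ^ n)))))

4^n≤[1+n]^[1+n] : ∀ n → 4 ^ n ≤ suc n ^ suc n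
4^n≤[1+n]^[1+n] 0                   = ≤-refl
4^n≤[1+n]^[1+n] 1                   = ≤-refl
4^n≤[1+n]^[1+n] 2                   = m≤m+n 16 11
4^n≤[1+n]^[1+n] (suc (suc (suc n))) =
  ≤-trans (^-monoʳ-≤ 4 (n≤1+n (3 + n))) (^-monoˡ-≤ (4 + n) (m≤m+n 4 n))

m*m<n*n⇒m<n : ∀ {m n} → m * m < n * n → m < n
m*m<n*n⇒m<n {m} {n} m*m<n*n with n ≤? m
... | yes n≤m = contradiction (*-mono-≤ n≤m n≤m) (<⇒≱ m*m<n*n)
... | no  n≰m = ≰⇒> n≰m

^-distribʳ-* : ∀ a b n → (a * b) ^ n ≡ a ^ n * b ^ n
^-distribʳ-* a b zero    = refl
^-distribʳ-* a b (suc n) =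
  trans (cong (a * b *_) (^-distribʳ-* a b n)) ([m*n]*[o*p]≡[m*o]*[n*p] a b (a ^ n) (b ^ n))

[1+k]^m<2^k : ∀ {m k} → suc k ≤ 2 * (m * m) → m ^ (5 * m) < 4 ^ (k ∸ 1) → suc k ^ m < 2 ^ k
[1+k]^m<2^k {suc m} {zero}  _       m^5m<1   = contradiction (m^n>0 (suc m) (5 * suc m)) (<⇒≱ m^5m<1)
[1+k]^m<2^k {suc m} {suc k} 2+k≤2m² m^5m<4^k = m*m<n*n⇒m<n (begin-strict
  A * A                          ≤⟨ *-mono-≤ A≤QP² A≤QP² ⟩
  (Q * (P * P)) * (Q * (P * P))  ≡⟨ [m*n]*[o*p]≡[m*o]*[n*p] Q (P * P) Q (P * P) ⟩
  (Q * Q) * ((P * P) * (P * P))  ≤⟨ *-monoˡ-≤ ((P * P) * (P * P)) Q²≤4P ⟩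
  (4 * P) * ((P * P) * (P * P))  ≡⟨ *-assoc 4 P ((P * P) * (P * P)) ⟩
  4 * (P * ((P * P) * (P * P)))  ≡⟨ cong (4 *_) P⁵≡M^5M ⟩
  4 * M ^ (5 * M)                <⟨ *-monoʳ-< 4 m^5m<4^k ⟩
  4 * 4 ^ k                      ≡⟨ ^-distribʳ-* 2 2 (suc k) ⟩
  2 ^ suc k * 2 ^ suc k          ∎)
  where
  open ≤-Reasoning
  M = suc m
  A = suc (suc k) ^ M
  P = M ^ M
  Q = 2 ^ M
  A≤QP² : A ≤ Q * (P * P)
  A≤QP² = ≤-trans (^-monoˡ-≤ M 2+k≤2m²)
            (≤-reflexive (trans (^-distribʳ-* 2 (M * M) M) (cong (Q *_) (^-distribʳ-* M M M))))
  Q²≤4P : Q * Q ≤ 4 * P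
  Q²≤4P = ≤-trans (≤-reflexive (sym (^-distribʳ-* 2 2 M))) (*-monoʳ-≤ 4 (4^n≤[1+n]^[1+n] m))
  p*p⁴≡p⁵ : ∀ p → p * ((p * p) * (p * p)) ≡ p * (p * (p * (p * (p * 1))))
  p*p⁴≡p⁵ = solve-∀
  P⁵≡M^5M : P * ((P * P) * (P * P)) ≡ M ^ (5 * M)
  P⁵≡M^5M = begin-equality
    P * ((P * P) * (P * P))  ≡⟨ p*p⁴≡p⁵ P ⟩
    P ^ 5                    ≡⟨ ^-*-assoc M M 5 ⟩
    M ^ (M * 5)              ≡⟨ cong (M ^_) (*-comm M 5) ⟩
    M ^ (5 * M)              ∎

[1+2m²]^m<2^[2m²] : ∀ {m} → 1 ≤ m → suc (2 * (m * m)) ^ m < 2 ^ (2 * (m * m))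
[1+2m²]^m<2^[2m²] {suc m} _ = begin-strict
  suc (2 * (M * M)) ^ M  <⟨ ^-monoˡ-< M 1+2M²<4M² ⟩
  (4 * (M * M)) ^ M      ≡⟨ ^-distribʳ-* 4 (M * M) M ⟩
  4 ^ M * (M * M) ^ M    ≤⟨ *-monoʳ-≤ (4 ^ M) (^-monoˡ-≤ M M²≤4^m) ⟩
  4 ^ M * (4 ^ m) ^ M    ≡⟨ cong (4 ^ M *_) (^-*-assoc 4 m M) ⟩
  4 ^ M * 4 ^ (m * M)    ≡⟨ ^-distribˡ-+-* 4 M (m * M) ⟨
  4 ^ (M * M)            ≡⟨ ^-*-assoc 2 2 (M * M) ⟩
  2 ^ (2 * (M * M))      ∎
  where
  open ≤-Reasoning
  M = suc m
  1≤M² : 1 ≤ M * M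
  1≤M² = *-mono-≤ (s≤s (z≤n {m})) (s≤s (z≤n {m}))
  1+2M²<4M² : suc (2 * (M * M)) < 4 * (M * M)
  1+2M²<4M² = ≤-trans (+-monoˡ-≤ (2 * (M * M)) (*-monoʳ-≤ 2 1≤M²))
                      (≤-reflexive (sym (*-distribʳ-+ (M * M) 2 2)))
  M²≤4^m : M * M ≤ 4 ^ m
  M²≤4^m = ≤-trans (*-mono-≤ (n<2^n m) (n<2^n m)) (≤-reflexive (sym (^-distribʳ-* 2 2 m)))

¬WithinBound⇒∃[1+s]^m<2^s : ∀ {m k} → 1 ≤ m → ¬ WithinBound m k →
                             ∃ λ s → s ≤ k × suc s ^ m < 2 ^ s
¬WithinBound⇒∃[1+s]^m<2^s {m} {k} 1≤m ¬bound with suc k ≤? 2 * (m * m)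
... | yes 1+k≤2m² = k , ≤-refl , [1+k]^m<2^k {m} {k} 1+k≤2m² (≰⇒> ¬bound)
... | no  1+k≰2m² = 2 * (m * m) , ≤-pred (≰⇒> 1+k≰2m²) , [1+2m²]^m<2^[2m²] 1≤m

lhs : BoolEq n → (Fin n → ℕ) → ℕ
lhs e x = sumFin (λ i → coef (BoolEq.a e i) * x i)

lhs-cong : (e : BoolEq n) {x y : Fin n → ℕ} → (∀ i → x i ≡ y i) → lhs e x ≡ lhs e y
lhs-cong e x≗y = sum-cong-≗ (λ i → cong (coef (BoolEq.a e i) *_) (x≗y i))

lhs-+ : (e : BoolEq n) (x y : Fin n → ℕ) → lhs e (λ i → x i + y i) ≡ lhs e x + lhs e y
lhs-+ e x y = trans (sum-cong-≗ (λ i → *-distribˡ-+ (a i) (x i) (y i)))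
                    (∑-distrib-+ (λ i → a i * x i) (λ i → a i * y i))
  where
  a : Fin _ → ℕ
  a = coef ∘ BoolEq.a e

exchange : (x u v : Fin n → ℕ) → Fin n → ℕ
exchange x u v i = x i ∸ u i + v i

m∸n+o+n≡m+o : ∀ {m n} o → n ≤ m → m ∸ n + o + n ≡ m + o
m∸n+o+n≡m+o {m} {n} o n≤m = trans (xy∙z≈xz∙y (m ∸ n) o n) (cong (_+ o) (m∸n+n≡m n≤m))

lhs-exchange : (e : BoolEq n) {x u : Fin n → ℕ} (v : Fin n → ℕ) → (∀ i → u i ≤ x i) →
               lhs e (exchange x u v) + lhs e u ≡ lhs e x + lhs e v
lhs-exchange e {x} {u} v u≤x = begin
  lhs e (exchange x u v) + lhs e u      ≡⟨ lhs-+ e (exchange x u v) u ⟨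
  lhs e (λ i → exchange x u v i + u i)  ≡⟨ lhs-cong e (λ i → m∸n+o+n≡m+o (v i) (u≤x i)) ⟩
  lhs e (λ i → x i + v i)               ≡⟨ lhs-+ e x v ⟩
  lhs e x + lhs e v                     ∎
  where open ≡-Reasoning

coef≤1 : ∀ b → coef b ≤ 1
coef≤1 false = z≤n
coef≤1 true  = ≤-refl

coef-*-≤ : ∀ b w → coef b * w ≤ w
coef-*-≤ false w = z≤n
coef-*-≤ true  w = ≤-reflexive (+-identityʳ w)

coef-≢ : ∀ {b c} → b ≢ c → (coef b ≡ 1 × coef c ≡ 0) ⊎ (coef b ≡ 0 × coef c ≡ 1)
coef-≢ {false} {false} b≢c = contradiction refl b≢c
coef-≢ {false} {true}  _   = inj₂ (refl , refl)
coef-≢ {true}  {false} _   = inj₁ (refl , refl)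
coef-≢ {true}  {true}  b≢c = contradiction refl b≢c

indicator : (Fin n → Bool) → Fin n → ℕ
indicator σ i = coef (σ i)

size : (Fin n → Bool) → ℕ
size σ = sumFin (indicator σ)

lhs-indicator≤size : (e : BoolEq n) (σ : Fin n → Bool) → lhs e (indicator σ) ≤ size σ
lhs-indicator≤size e σ = sumFin-mono-≤ (λ i → coef-*-≤ (BoolEq.a e i) (indicator σ i))

support : (Fin n → ℕ) → Pred (Fin n) 0ℓ
support x i = 0 < x i

indicator-≤ : (σ : Fin n → Bool) {x : Fin n → ℕ} → T ∘ σ ⊆ support x → ∀ i → indicator σ i ≤ x i
indicator-≤ σ σ⊆x i with σ i | σ⊆x {i}
... | false | _      = z≤n
... | true  | 0<x[i] = 0<x[i] tt

nonZero≤1 : ∀ v → nonZero v ≤ 1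
nonZero≤1 zero    = z≤n
nonZero≤1 (suc _) = ≤-refl

nonZero-∸-+ : ∀ {w} u {v} → v ≤ w → nonZero (w ∸ u + v) ≤ nonZero w
nonZero-∸-+ {zero}  zero    z≤n = z≤n
nonZero-∸-+ {zero}  (suc u) z≤n = z≤n
nonZero-∸-+ {suc w} u       _   = nonZero≤1 (suc w ∸ u + _)

nonZero-< : ∀ {v w} → v ≡ 0 → 0 < w → nonZero v < nonZero w
nonZero-< refl (s≤s _) = s≤s z≤n

≮⇒support-⊆ : {x y : Fin n → ℕ} → (∀ i → nonZero (y i) ≤ nonZero (x i)) →
              ¬ supportSize y < supportSize x → support x ⊆ support y
≮⇒support-⊆ {y = y} nz[y]≤nz[x] ≮ {i} 0<x[i] with y i in y[i]≡
... | zero  = contradiction (sumFin-mono-< nz[y]≤nz[x] i (nonZero-< y[i]≡ 0<x[i])) ≮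
... | suc _ = s≤s z≤n

0<+coef : ∀ w {b} → T b → 0 < w + coef b
0<+coef w {true} _ = m≤n+m 1 w

∸-+-≤-pred : ∀ {u v w k} → u ≡ 1 → v ≡ 0 → w ≤ suc k → w ∸ u + v ≤ k
∸-+-≤-pred {w = w} refl refl w≤1+k =
  ≤-trans (≤-reflexive (+-identityʳ (w ∸ 1))) (∸-monoˡ-≤ 1 w≤1+k)

-- mask x β writes the bits of β, in order, on the first s positions of the support of x.
mutual
  mask : (Fin n → ℕ) → (Fin s → Bool) → Fin n → Bool
  mask {zero}  x β = []
  mask {suc n} x β = maskCons (x zero) (tail x) β

  maskCons : ℕ → (Fin n → ℕ) → (Fin s → Bool) → Fin (suc n) → Bool
  maskCons             zero    x β = false ∷ mask x β
  maskCons {s = zero}  (suc _) x β = false ∷ mask x β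
  maskCons {s = suc s} (suc _) x β = head β ∷ mask x (tail β)

mutual
  mask-⊆ : (x : Fin n → ℕ) (β : Fin s → Bool) → T ∘ mask x β ⊆ support x
  mask-⊆ {suc n} x β {zero}  = maskCons-⊆ (x zero) (tail x) β {zero}
  mask-⊆ {suc n} x β {suc i} = maskCons-⊆ (x zero) (tail x) β {suc i}

  maskCons-⊆ : ∀ v (x : Fin n → ℕ) (β : Fin s → Bool) → T ∘ maskCons v x β ⊆ support (v ∷ x)
  maskCons-⊆             zero    x β {suc i}   = mask-⊆ x β
  maskCons-⊆ {s = zero}  (suc v) x β {suc i}   = mask-⊆ x β
  maskCons-⊆ {s = suc s} (suc v) x β {zero}  _ = s≤s z≤n
  maskCons-⊆ {s = suc s} (suc v) x β {suc i}   = mask-⊆ x (tail β)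

mutual
  size-mask : (x : Fin n → ℕ) (β : Fin s → Bool) → size (mask x β) ≤ s
  size-mask {zero}  x β = z≤n
  size-mask {suc n} x β = size-maskCons (x zero) (tail x) β

  size-maskCons : ∀ v (x : Fin n → ℕ) (β : Fin s → Bool) → size (maskCons v x β) ≤ s
  size-maskCons             zero    x β = size-mask x β
  size-maskCons {s = zero}  (suc v) x β = size-mask x β
  size-maskCons {s = suc s} (suc v) x β = +-mono-≤ (coef≤1 (head β)) (size-mask x (tail β))

mutual
  mask-≢ : (x : Fin n → ℕ) {β β′ : Fin s → Bool} → s ≤ supportSize x →
           ∀ {k} → β k ≢ β′ k → ∃ λ i → mask x β i ≢ mask x β′ i
  mask-≢ {zero}  {zero} x _ {()}
  mask-≢ {suc n}        x s≤∣x∣ = maskCons-≢ (x zero) (tail x) s≤∣x∣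

  maskCons-≢ : ∀ v (x : Fin n → ℕ) {β β′ : Fin s → Bool} → s ≤ nonZero v + supportSize x →
               ∀ {k} → β k ≢ β′ k → ∃ λ i → maskCons v x β i ≢ maskCons v x β′ i
  maskCons-≢             zero    x s≤∣x∣ β≢β′ =
    let i , mask≢ = mask-≢ x s≤∣x∣ β≢β′ in suc i , mask≢
  maskCons-≢ {s = zero}  (suc v) x _ {()}
  maskCons-≢ {s = suc s} (suc v) x _ {zero} β≢β′ = zero , β≢β′
  maskCons-≢ {s = suc s} (suc v) x (s≤s s≤∣x∣) {suc k} β≢β′ =
    let i , mask≢ = mask-≢ x s≤∣x∣ β≢β′ in suc i , mask≢

bit : Fin 2 → Bool
bit = Inverse.to 2↔Bool

bit-injective : ∀ {a b} → bit a ≡ bit b → a ≡ b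
bit-injective = Injection.injective (↔⇒↣ 2↔Bool)

module _ {m n} (E : System m n) where

  Smaller : (Fin n → ℕ) → Set
  Smaller x = ∃ λ y → IsSolution E y × supportSize y < supportSize x

  Balanced : (σ τ : Fin n → Bool) → Set
  Balanced σ τ = ∀ j → lhs (E j) (indicator σ) ≡ lhs (E j) (indicator τ)

  exchange-isSolution : {x u v : Fin n → ℕ} → IsSolution E x → (∀ i → u i ≤ x i) →
                        (∀ j → lhs (E j) u ≡ lhs (E j) v) → IsSolution E (exchange x u v)
  exchange-isSolution {x} {u} {v} sol u≤x balanced j =
    +-cancelʳ-≡ (lhs (E j) u) _ _ (begin
      lhs (E j) (exchange x u v) + lhs (E j) u  ≡⟨ lhs-exchange (E j) v u≤x ⟩
      lhs (E j) x + lhs (E j) v                 ≡⟨ cong₂ _+_ (sol j) (sym (balanced j)) ⟩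
      BoolEq.c (E j) + lhs (E j) u              ∎)
    where open ≡-Reasoning

  -- Unless an exchange already shrinks the support, it keeps σ and τ inside the support and lowers
  -- x i₀ by one; so within x i₀ exchanges the support shrinks.
  exchange-until-smaller : ∀ k {x σ τ i₀} → IsSolution E x →
                           T ∘ σ ⊆ support x → T ∘ τ ⊆ support x → Balanced σ τ →
                           indicator σ i₀ ≡ 1 → indicator τ i₀ ≡ 0 → x i₀ ≤ k → Smaller x
  exchange-until-smaller zero {x} {σ} {i₀ = i₀} _ σ⊆x _ _ σ[i₀]≡1 _ x[i₀]≤0 =
    contradiction (≤-trans (subst (_≤ x i₀) σ[i₀]≡1 (indicator-≤ σ σ⊆x i₀)) x[i₀]≤0) λ ()
  exchange-until-smaller (suc k) {x} {σ} {τ} sol σ⊆x τ⊆x balanced σ[i₀]≡1 τ[i₀]≡0 x[i₀]≤1+k =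
    stop-or-continue (supportSize y <? supportSize x)
    where
    y : Fin n → ℕ
    y = exchange x (indicator σ) (indicator τ)
    sol′ : IsSolution E y
    sol′ = exchange-isSolution {v = indicator τ} sol (indicator-≤ σ σ⊆x) balanced
    nz[y]≤nz[x] : ∀ i → nonZero (y i) ≤ nonZero (x i)
    nz[y]≤nz[x] i = nonZero-∸-+ (indicator σ i) (indicator-≤ τ τ⊆x i)
    τ⊆y : T ∘ τ ⊆ support y
    τ⊆y {i} = 0<+coef (x i ∸ indicator σ i)
    stop-or-continue : Dec (supportSize y < supportSize x) → Smaller x
    stop-or-continue (yes y<x) = y , sol′ , y<x
    stop-or-continue (no  y≮x)
      with z , sol″ , z<y ←
             exchange-until-smaller k sol′ (⊆-trans {j = support x} σ⊆x (≮⇒support-⊆ nz[y]≤nz[x] y≮x))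
               τ⊆y balanced σ[i₀]≡1 τ[i₀]≡0 (∸-+-≤-pred σ[i₀]≡1 τ[i₀]≡0 x[i₀]≤1+k)
      = z , sol″ , <-≤-trans z<y (sumFin-mono-≤ nz[y]≤nz[x])

  balanced⇒smaller : ∀ {x σ τ i₀} → IsSolution E x →
                     T ∘ σ ⊆ support x → T ∘ τ ⊆ support x → Balanced σ τ → σ i₀ ≢ τ i₀ →
                     Smaller x
  balanced⇒smaller {x} {i₀ = i₀} sol σ⊆x τ⊆x balanced σ[i₀]≢τ[i₀] with coef-≢ σ[i₀]≢τ[i₀]
  ... | inj₁ (σ[i₀]≡1 , τ[i₀]≡0) =
    exchange-until-smaller (x i₀) sol σ⊆x τ⊆x balanced σ[i₀]≡1 τ[i₀]≡0 ≤-refl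
  ... | inj₂ (σ[i₀]≡0 , τ[i₀]≡1) =
    exchange-until-smaller (x i₀) sol τ⊆x σ⊆x (sym ∘ balanced) τ[i₀]≡1 σ[i₀]≡0 ≤-refl

  [1+s]^m<2^s⇒smaller : ∀ {x s} → IsSolution E x → s ≤ supportSize x → suc s ^ m < 2 ^ s →
                        Smaller x
  [1+s]^m<2^s⇒smaller {x} {s} sol s≤∣x∣ [1+s]^m<2^s
    with u , v , (k , u[k]≢v[k]) , balanced ←
           pigeonhole-→ [1+s]^m<2^s (λ β j → lhs (E j) (indicator (mask x (bit ∘ β))))
             (λ β j → s≤s (≤-trans (lhs-indicator≤size (E j) (mask x (bit ∘ β)))
                                   (size-mask x (bit ∘ β))))
    = balanced⇒smaller sol (mask-⊆ x (bit ∘ u)) (mask-⊆ x (bit ∘ v)) balanced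
                       (proj₂ (mask-≢ x s≤∣x∣ (u[k]≢v[k] ∘ bit-injective)))

proposition5 : (m n : ℕ) → 1 ≤ m → (E : System m n) →
    Σ (Fin n → ℕ) (λ x → IsSolution E x) →
    Σ (Fin n → ℕ) (λ y → IsSolution E y × WithinBound m (supportSize y))
proposition5 m n 1≤m E (x , sol) = descent supportSize within-or-smaller x sol
  where
  within-or-smaller : ∀ x → IsSolution E x → WithinBound m (supportSize x) ⊎ Smaller E x
  within-or-smaller x sol with 4 ^ (supportSize x ∸ 1) ≤? m ^ (5 * m)
  ... | yes bound = inj₁ bound
  ... | no ¬bound =
    let s , s≤∣x∣ , [1+s]^m<2^s = ¬WithinBound⇒∃[1+s]^m<2^s 1≤m ¬bound
    in inj₂ ([1+s]^m<2^s⇒smaller E sol s≤∣x∣ [1+s]^m<2^s)
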